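{- Let $p$ be an odd prime. Then the edge set of the complete graph $K_{p^4}$ can be partitioned into $(p^4-1)/4$ subgraphs, each isomorphic to $C_{p^2} \square C_{p^2}$.
   Context: $C_n$ denotes the cycle graph on $n$ vertices. For graphs $G=(V,E)$ and $G'=(V',E')$, the Cartesian product $G \square G'$ has vertex set $V \times V'$, with $(v,v')$ and $(w,w')$ adjacent iff either $\{v,w\}\in E$ and $v'=w'$, or $v=w$ and $\{v',w'\}\in E'$. A partition of $K_m$ into subgraphs means a collection of subgraphs of $K_m$ whose edge sets are pairwise disjoint and together cover all edges of $K_m$. -}

module Defs where

open import Data.Nat using (ℕ; suc; _∸_)
open import Data.Fin using (Fin; toℕ)
open import Data.Product using (_×_; Σ; ∃; _,_)
open import Data.Sum using (_⊎_)
open import Relation.Nullary using (¬_)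
open import Relation.Binary.PropositionalEquality using (_≡_)
open import Function.Definitions using (Injective)

Graph : Set → Set₁
Graph V = V → V → Set

CycSucc : (n : ℕ) → Fin n → Fin n → Set
CycSucc n a b = (toℕ b ≡ suc (toℕ a)) ⊎ ((toℕ a ≡ n ∸ 1) × (toℕ b ≡ 0))

-- The cycle graph C_n on vertex set Fin n (meaningful for n ≥ 3)
Cycle : (n : ℕ) → Graph (Fin n)
Cycle n a b = CycSucc n a b ⊎ CycSucc n b a

_□_ : {V W : Set} → Graph V → Graph W → Graph (V × W)
(G □ H) (v , v') (w , w') = (G v w × v' ≡ w') ⊎ (v ≡ w × H v' w')

InCopy : {V : Set} {m : ℕ} → Graph V → (V → Fin m) → Fin m → Fin m → Set
InCopy {V} G f u v = Σ V λ a → Σ V λ b → G a b × f a ≡ u × f b ≡ v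

-- A partition of the edges of K_m into k subgraphs, each isomorphic to G
-- (G has no isolated vertices here, so a subgraph isomorphic to G is the
-- image of an injective vertex map V → Fin m together with the edges of G).
PartitionInto : {V : Set} → (m k : ℕ) → Graph V → Set
PartitionInto {V} m k G =
  Σ (Fin k → V → Fin m) λ f →
    ((i : Fin k) → Injective _≡_ _≡_ (f i)) ×
    ((u v : Fin m) → ¬ (u ≡ v) →
      Σ (Fin k) λ i → InCopy G (f i) u v ×
        ((j : Fin k) → InCopy G (f j) u v → j ≡ i))

module Submission where

-- Walecki: for M ≥ 1 the complete graph on ∞ and ℤ_{2M} is the edge-disjoint union of the M
-- Hamiltonian cycles ∞, i, i + 1, i − 1, i + 2, i − 2, …, i + M, ∞ (i < M). The finite edges of
-- the i-th cycle are the {x, y} with ⌊((x + y) mod 2M)/2⌋ = i, and its edges at ∞ go to i and i + M.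
--
-- Let n = 2M + 1 and let C_0, …, C_{M-1} be these cycles, as spanning copies of C_n in K_n.
-- An edge of K_{n²} on ℤ_n × ℤ_n that keeps one coordinate lies in exactly one C_i □ C_i; one
-- that changes both coordinates lies in exactly one tensor product C_i ⊗ C_j. For odd n the map
-- (u, v) ↦ (u + v, u − v) is an isomorphism C_n □ C_n ≅ C_n ⊗ C_n, so K_{n²} is the edge-disjoint
-- union of M + M² = (n² − 1)/4 copies of C_n □ C_n. For an odd prime p take n = p².

open import Algebra.Properties.CommutativeSemigroup using (interchange)
open import Data.Empty using (⊥; ⊥-elim)
open import Data.Fin using (Fin; zero; suc; toℕ; fromℕ; fromℕ<; inject₁; punchOut)
open import Data.Fin.Properties
  using (+↔⊎; *↔×; toℕ-fromℕ; toℕ-fromℕ<; toℕ-inject₁; toℕ-injective; toℕ<n; any?;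
         punchOut-injective; injective⇒≤)
  renaming (_≟_ to _≟ᶠ_; suc-injective to sucᶠ-injective)
open import Data.Nat
  using (ℕ; zero; suc; _+_; _*_; _∸_; _^_; _/_; _%_; _<_; _≤_; _<?_; z≤n; s≤s; z<s;
         NonZero; >-nonZero⁻¹; parity; ⌊_/2⌋)
open import Data.Nat.DivMod
  using (_mod_; %-distribˡ-+; %-distribˡ-*; [m+kn]%n≡m%n; [m+n]%n≡m%n; m%n%n≡m%n; m%n<n;
         m<n⇒m%n≡m; m*n%n≡0; n%n≡0; m≤n⇒[n∸m]%m≡n%m; m*n/n≡m)
open import Data.Nat.Divisibility using (divides)
open import Data.Nat.Primality using (Prime; prime⇒irreducible; ¬prime[1])
open import Data.Nat.Properties
  using (+-comm; +-assoc; +-suc; *-suc; +-identityʳ; +-commutativeSemigroup; suc-injective;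
         1+n≢0; n≮n; <-trans; ≤-<-trans; ≰⇒>; <⇒≱; ≮⇒≥; m≤n⇒m<n∨m≡n; m<m+n; m≤n+m;
         +-mono-≤; +-mono-<; +-mono-<-≤; +-monoˡ-<; +-cancelʳ-<; m∸n+n≡m; m+[n∸m]≡n;
         n≡⌊n+n/2⌋; n≡⌈n+n/2⌉; ^-distribˡ-+-*)
open import Data.Nat.Tactic.RingSolver using (solve-∀)
open import Data.Parity.Base using (Parity; 0ℙ; 1ℙ; _⁻¹) renaming (_+_ to _+ℙ_)
import Data.Parity.Properties as ℙ
open import Data.Product using (_×_; Σ; _,_; proj₁; proj₂)
import Data.Product as Product
open import Data.Sum using (_⊎_; inj₁; inj₂)
import Data.Sum as Sum
open import Data.Sum.Function.Propositional using (_⊎-↔_)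
open import Function using (_∘_; _↔_; Inverse; mk↔ₛ′)
open import Function.Definitions using (Injective; StrictlySurjective)
open import Function.Properties.Inverse using (↔-refl; ↔-sym; ↔-trans)
open import Relation.Binary using (Setoid; IsEquivalence; DecidableEquality)
open import Relation.Binary.PropositionalEquality
import Relation.Binary.Reasoning.Setoid
open import Relation.Nullary using (¬_; yes; no)

open import Defs

InImage : {V T : Set} → Graph V → (V → T) → T → T → Set
InImage {V} G f u v = Σ V λ a → Σ V λ b → G a b × f a ≡ u × f b ≡ v

InImage-swap : ∀ {V T} {G : Graph V} {f : V → T} {u v} →
               (∀ {a b} → G a b → G b a) → InImage G f u v → InImage G f v u
InImage-swap G-sym (a , b , g , fa , fb) = b , a , G-sym g , fb , fa

record IsPartition {I V T : Set} (G : Graph V) (f : I → V → T) : Set where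
  field
    injective : ∀ i → Injective _≡_ _≡_ (f i)
    class     : (u v : T) → u ≢ v → I
    covers    : ∀ {u v} (u≢v : u ≢ v) → InImage G (f (class u v u≢v)) u v
    unique    : ∀ {u v} (u≢v : u ≢ v) i → InImage G (f i) u v → class u v u≢v ≡ i

isPartition⇒partitionInto : ∀ {V m k} {G : Graph V} {f : Fin k → V → Fin m} →
                            IsPartition G f → PartitionInto m k G
isPartition⇒partitionInto {f = f} P =
  f , injective , λ u v u≢v → class u v u≢v , covers u≢v , λ j e → sym (unique u≢v j e)
  where open IsPartition P

module _ {I J V T U : Set} {G : Graph V} {f : I → V → T} (ι : J ↔ I) (τ : T ↔ U) where
  open Inverse using (to; from; strictlyInverseˡ; strictlyInverseʳ)

  isPartition-↔ : IsPartition G f → IsPartition G (λ j → to τ ∘ f (to ι j))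
  isPartition-↔ P = record
    { injective = λ j → P.injective (to ι j) ∘ to-injective
    ; class     = class
    ; covers    = covers
    ; unique    = unique
    }
    where
    module P = IsPartition P

    to-injective : ∀ {x y} → to τ x ≡ to τ y → x ≡ y
    to-injective {x} {y} eq =
      trans (sym (strictlyInverseʳ τ x)) (trans (cong (from τ) eq) (strictlyInverseʳ τ y))

    from-injective : ∀ {u v} → from τ u ≡ from τ v → u ≡ v
    from-injective {u} {v} eq =
      trans (sym (strictlyInverseˡ τ u)) (trans (cong (to τ) eq) (strictlyInverseˡ τ v))

    class : (u v : U) → u ≢ v → J
    class u v u≢v = from ι (P.class (from τ u) (from τ v) (u≢v ∘ from-injective))

    covers : ∀ {u v} (u≢v : u ≢ v) → InImage G (to τ ∘ f (to ι (class u v u≢v))) u v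
    covers {u} {v} u≢v
      rewrite strictlyInverseˡ ι (P.class (from τ u) (from τ v) (u≢v ∘ from-injective))
      with a , b , g , fa , fb ← P.covers (u≢v ∘ from-injective) =
      a , b , g , trans (cong (to τ) fa) (strictlyInverseˡ τ u) ,
                  trans (cong (to τ) fb) (strictlyInverseˡ τ v)

    unique : ∀ {u v} (u≢v : u ≢ v) j → InImage G (to τ ∘ f (to ι j)) u v → class u v u≢v ≡ j
    unique u≢v j (a , b , g , refl , refl) = trans
      (cong (from ι) (P.unique _ (to ι j)
        (a , b , g , sym (strictlyInverseʳ τ _) , sym (strictlyInverseʳ τ _))))
      (strictlyInverseʳ ι j)

injective⇒surjective : ∀ {n} {f : Fin n → Fin n} → Injective _≡_ _≡_ f → StrictlySurjective _≡_ f
injective⇒surjective {n} {f} f-inj y with any? (λ x → f x ≟ᶠ y)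
... | yes fx≡y = fx≡y
injective⇒surjective {suc n} {f} f-inj y | no ∄x = ⊥-elim (n≮n n (injective⇒≤ f̂-inj))
  where
  y≢f : ∀ x → y ≢ f x
  y≢f x y≡fx = ∄x (x , sym y≡fx)
  f̂ : Fin (suc n) → Fin n
  f̂ x = punchOut (y≢f x)
  f̂-inj : Injective _≡_ _≡_ f̂
  f̂-inj {x} {x′} eq = f-inj (punchOut-injective (y≢f x) (y≢f x′) eq)

bit : Parity → ℕ
bit 0ℙ = 0
bit 1ℙ = 1

unhalve : Parity → ℕ → ℕ
unhalve π s = bit π + (s + s)

parity-unhalve : ∀ π s → parity (unhalve π s) ≡ π
parity-unhalve π s = begin
  parity (bit π + (s + s))                  ≡⟨ ℙ.+-homo-+ (bit π) (s + s) ⟩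
  parity (bit π) +ℙ parity (s + s)          ≡⟨ cong (parity (bit π) +ℙ_) (ℙ.+-homo-+ s s) ⟩
  parity (bit π) +ℙ (parity s +ℙ parity s)  ≡⟨ cong (parity (bit π) +ℙ_) (ℙ.p+p≡0ℙ (parity s)) ⟩
  parity (bit π) +ℙ 0ℙ                      ≡⟨ ℙ.+-identityʳ (parity (bit π)) ⟩
  parity (bit π)                            ≡⟨ parity-bit π ⟩
  π                                         ∎
  where
  open ≡-Reasoning
  parity-bit : ∀ π → parity (bit π) ≡ π
  parity-bit 0ℙ = refl
  parity-bit 1ℙ = refl

⌊unhalve/2⌋ : ∀ π s → ⌊ unhalve π s /2⌋ ≡ s
⌊unhalve/2⌋ 0ℙ s = sym (n≡⌊n+n/2⌋ s)
⌊unhalve/2⌋ 1ℙ s = sym (n≡⌈n+n/2⌉ s)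

unhalve-⌊/2⌋ : ∀ t → unhalve (parity t) ⌊ t /2⌋ ≡ t
unhalve-⌊/2⌋ 0 = refl
unhalve-⌊/2⌋ 1 = refl
unhalve-⌊/2⌋ (suc (suc t)) =
  trans (unhalve-suc (bit (parity t)) ⌊ t /2⌋) (cong (2 +_) (unhalve-⌊/2⌋ t))
  where
  unhalve-suc : ∀ b s → b + (suc s + suc s) ≡ suc (suc (b + (s + s)))
  unhalve-suc = solve-∀

half-< : ∀ {s k} → s + s < k + k → s < k
half-< s+s<k+k = ≰⇒> (λ k≤s → <⇒≱ s+s<k+k (+-mono-≤ k≤s k≤s))

≢⇒≡⁻¹ : ∀ {p q : Parity} → p ≢ q → p ≡ q ⁻¹
≢⇒≡⁻¹ {0ℙ} {0ℙ} p≢q = ⊥-elim (p≢q refl)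
≢⇒≡⁻¹ {0ℙ} {1ℙ} _   = refl
≢⇒≡⁻¹ {1ℙ} {0ℙ} _   = refl
≢⇒≡⁻¹ {1ℙ} {1ℙ} p≢q = ⊥-elim (p≢q refl)

module Modulo (n : ℕ) .{{_ : NonZero n}} where

  infix 4 _≈_
  record _≈_ (x y : ℕ) : Set where
    constructor mk≈
    field %-≡ : x % n ≡ y % n
  open _≈_ public

  ≈-isEquivalence : IsEquivalence _≈_
  ≈-isEquivalence = record
    { refl  = mk≈ refl
    ; sym   = λ (mk≈ p) → mk≈ (sym p)
    ; trans = λ (mk≈ p) (mk≈ q) → mk≈ (trans p q)
    }

  ≈-setoid : Setoid _ _
  ≈-setoid = record { isEquivalence = ≈-isEquivalence }

  open IsEquivalence ≈-isEquivalence public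
    using () renaming (refl to ≈-refl; sym to ≈-sym; trans to ≈-trans; reflexive to ≡⇒≈)

  module ≈-Reasoning = Relation.Binary.Reasoning.Setoid ≈-setoid

  +-cong : ∀ {x x′ y y′} → x ≈ x′ → y ≈ y′ → x + y ≈ x′ + y′
  +-cong {x} {x′} {y} {y′} (mk≈ p) (mk≈ q) = mk≈ (begin
    (x + y) % n             ≡⟨ %-distribˡ-+ x y n ⟩
    (x % n + y % n) % n     ≡⟨ cong₂ (λ a b → (a + b) % n) p q ⟩
    (x′ % n + y′ % n) % n   ≡⟨ %-distribˡ-+ x′ y′ n ⟨
    (x′ + y′) % n           ∎)
    where open ≡-Reasoning

  *-cong : ∀ {x x′ y y′} → x ≈ x′ → y ≈ y′ → x * y ≈ x′ * y′
  *-cong {x} {x′} {y} {y′} (mk≈ p) (mk≈ q) = mk≈ (begin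
    (x * y) % n               ≡⟨ %-distribˡ-* x y n ⟩
    (x % n * (y % n)) % n     ≡⟨ cong₂ (λ a b → (a * b) % n) p q ⟩
    (x′ % n * (y′ % n)) % n   ≡⟨ %-distribˡ-* x′ y′ n ⟨
    (x′ * y′) % n             ∎)
    where open ≡-Reasoning

  +-congˡ : ∀ z {x y} → x ≈ y → z + x ≈ z + y
  +-congˡ z = +-cong (≈-refl {z})

  *-congˡ : ∀ z {x y} → x ≈ y → z * x ≈ z * y
  *-congˡ z = *-cong (≈-refl {z})

  m+kn≈m : ∀ x k → x + k * n ≈ x
  m+kn≈m x k = mk≈ ([m+kn]%n≡m%n x k n)

  m%n≈m : ∀ x → x % n ≈ x
  m%n≈m x = mk≈ (m%n%n≡m%n x n)

  n≈0 : n ≈ 0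
  n≈0 = mk≈ (trans (n%n≡0 n) (sym (m<n⇒m%n≡m (>-nonZero⁻¹ n))))

  ≈⇒≡ : ∀ {x y} → x < n → y < n → x ≈ y → x ≡ y
  ≈⇒≡ x<n y<n (mk≈ p) = trans (sym (m<n⇒m%n≡m x<n)) (trans p (m<n⇒m%n≡m y<n))

  toℕ-mod : ∀ x → toℕ (x mod n) ≈ x
  toℕ-mod x = ≈-trans (≡⇒≈ (toℕ-fromℕ< (m%n<n x n))) (m%n≈m x)

  toℕ-≈⇒≡ : ∀ {a b : Fin n} → toℕ a ≈ toℕ b → a ≡ b
  toℕ-≈⇒≡ {a} {b} = toℕ-injective ∘ ≈⇒≡ (toℕ<n a) (toℕ<n b)

  mod-cong : ∀ {x y} → x ≈ y → x mod n ≡ y mod n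
  mod-cong {x} {y} x≈y = toℕ-≈⇒≡ (≈-trans (toℕ-mod x) (≈-trans x≈y (≈-sym (toℕ-mod y))))

  ≈toℕ⇒mod≡ : ∀ {x a} → x ≈ toℕ a → x mod n ≡ a
  ≈toℕ⇒mod≡ {x} x≈a = toℕ-≈⇒≡ (≈-trans (toℕ-mod x) x≈a)

  suc[n∸1]≡n : suc (n ∸ 1) ≡ n
  suc[n∸1]≡n = m+[n∸m]≡n (>-nonZero⁻¹ n)

  -- −x modulo n, written without truncated subtraction.
  neg : ℕ → ℕ
  neg x = x * (n ∸ 1)

  neg-cong : ∀ {x y} → x ≈ y → neg x ≈ neg y
  neg-cong x≈y = *-cong x≈y ≈-refl

  +-inverseʳ : ∀ x → x + neg x ≈ 0
  +-inverseʳ x = begin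
    x + x * (n ∸ 1)   ≡⟨ *-suc x (n ∸ 1) ⟨
    x * suc (n ∸ 1)   ≡⟨ cong (x *_) suc[n∸1]≡n ⟩
    x * n             ≈⟨ mk≈ (trans (m*n%n≡0 x n) (sym (m<n⇒m%n≡m (>-nonZero⁻¹ n)))) ⟩
    0                 ∎
    where open ≈-Reasoning

  neg-cancelˡ : ∀ z x → neg z + (z + x) ≈ x
  neg-cancelˡ z x = begin
    neg z + (z + x)   ≡⟨ +-assoc (neg z) z x ⟨
    neg z + z + x     ≈⟨ +-cong (≈-trans (≡⇒≈ (+-comm (neg z) z)) (+-inverseʳ z)) ≈-refl ⟩
    x                 ∎
    where open ≈-Reasoning

  +-cancelˡ : ∀ z {x y} → z + x ≈ z + y → x ≈ y
  +-cancelˡ z {x} {y} eq = begin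
    x                 ≈⟨ neg-cancelˡ z x ⟨
    neg z + (z + x)   ≈⟨ +-congˡ (neg z) eq ⟩
    neg z + (z + y)   ≈⟨ neg-cancelˡ z y ⟩
    y                 ∎
    where open ≈-Reasoning

  neg-injective : ∀ {x y} → neg x ≈ neg y → x ≈ y
  neg-injective {x} {y} eq = ≈-sym (+-cancelˡ (neg x) (begin
    neg x + y   ≡⟨ +-comm (neg x) y ⟩
    y + neg x   ≈⟨ +-congˡ y eq ⟩
    y + neg y   ≈⟨ +-inverseʳ y ⟩
    0           ≈⟨ +-inverseʳ x ⟨
    x + neg x   ≡⟨ +-comm x (neg x) ⟩
    neg x + x   ∎))
    where open ≈-Reasoning

  Step : ℕ → ℕ → Set
  Step x y = y ≈ suc x

  Adjacent : ℕ → ℕ → Set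
  Adjacent x y = Step x y ⊎ Step y x

  step-resp : ∀ {x x′ y y′} → x ≈ x′ → y ≈ y′ → Step x y → Step x′ y′
  step-resp x≈x′ y≈y′ y≈1+x = ≈-trans (≈-sym y≈y′) (≈-trans y≈1+x (+-congˡ 1 x≈x′))

  cycSucc⇒step : ∀ {a b : Fin n} → CycSucc n a b → Step (toℕ a) (toℕ b)
  cycSucc⇒step (inj₁ b≡1+a) = ≡⇒≈ b≡1+a
  cycSucc⇒step (inj₂ (a≡n∸1 , b≡0)) =
    ≈-trans (≡⇒≈ b≡0) (≈-trans (≈-sym n≈0) (≡⇒≈ (trans (sym suc[n∸1]≡n) (cong suc (sym a≡n∸1)))))

  step⇒cycSucc : ∀ {a b : Fin n} → Step (toℕ a) (toℕ b) → CycSucc n a b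
  step⇒cycSucc {a} {b} b≈1+a with m≤n⇒m<n∨m≡n (toℕ<n a)
  ... | inj₁ 1+a<n = inj₁ (≈⇒≡ (toℕ<n b) 1+a<n b≈1+a)
  ... | inj₂ 1+a≡n = inj₂ (cong (_∸ 1) 1+a≡n ,
                          ≈⇒≡ (toℕ<n b) (>-nonZero⁻¹ n) (≈-trans b≈1+a (≈-trans (≡⇒≈ 1+a≡n) n≈0)))

  cycle⇒adjacent : ∀ {a b : Fin n} → Cycle n a b → Adjacent (toℕ a) (toℕ b)
  cycle⇒adjacent = Sum.map cycSucc⇒step cycSucc⇒step

  adjacent⇒cycle : ∀ {x y} → Adjacent x y → Cycle n (x mod n) (y mod n)
  adjacent⇒cycle {x} {y} =
    Sum.map (step⇒cycSucc ∘ step-resp (≈-sym (toℕ-mod x)) (≈-sym (toℕ-mod y)))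
            (step⇒cycSucc ∘ step-resp (≈-sym (toℕ-mod y)) (≈-sym (toℕ-mod x)))

  step-irrefl : 1 < n → ∀ {x} → ¬ Step x x
  step-irrefl 1<n {x} x≈1+x with ≈⇒≡ (>-nonZero⁻¹ n) 1<n
    (+-cancelˡ x (≈-trans (≡⇒≈ (+-identityʳ x)) (≈-trans x≈1+x (≡⇒≈ (+-comm 1 x)))))
  ... | ()

  cycle-irrefl : 1 < n → ∀ {a : Fin n} → ¬ Cycle n a a
  cycle-irrefl 1<n c with cycle⇒adjacent c
  ... | inj₁ a→a = step-irrefl 1<n a→a
  ... | inj₂ a→a = step-irrefl 1<n a→a

  +-stepˡ : ∀ z {x y} → Step x y → Step (z + x) (z + y)
  +-stepˡ z {x} y≈1+x = ≈-trans (+-congˡ z y≈1+x) (≡⇒≈ (+-suc z x))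

  +-stepʳ : ∀ z {x y} → Step x y → Step (x + z) (y + z)
  +-stepʳ z y≈1+x = +-cong y≈1+x ≈-refl

  neg-step : ∀ {x y} → Step x y → Step (neg y) (neg x)
  neg-step {x} {y} y≈1+x = ≈-sym (begin
    suc (neg y)           ≈⟨ +-congˡ 1 (neg-cong y≈1+x) ⟩
    suc (n ∸ 1 + neg x)   ≡⟨ cong (_+ neg x) suc[n∸1]≡n ⟩
    n + neg x             ≈⟨ +-cong n≈0 ≈-refl ⟩
    neg x                 ∎)
    where open ≈-Reasoning

  step-cancel : ∀ {x x′ y y′} → Step x x′ → Step y′ y → x + y ≈ x′ + y′
  step-cancel {x} {x′} {y} {y′} x′≈1+x y≈1+y′ = begin
    x + y        ≈⟨ +-congˡ x y≈1+y′ ⟩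
    x + suc y′   ≡⟨ +-suc x y′ ⟩
    suc x + y′   ≈⟨ +-cong x′≈1+x ≈-refl ⟨
    x′ + y′      ∎
    where open ≈-Reasoning

-- Walecki's decomposition of K_{2M+1} into Hamiltonian cycles

module Walecki (a : ℕ) where

  M : ℕ
  M = suc a

  m : ℕ
  m = M + M

  open Modulo m
  module ModM = Modulo M

  M<m : M < m
  M<m = s≤s (m<m+n a z<s)

  zig : Parity → ℕ → ℕ
  zig 0ℙ s = neg s
  zig 1ℙ s = suc s

  -- 0, 1, −1, 2, −2, …, M: the offsets from i along the i-th Hamiltonian path of ℤ_m.
  zigzag : ℕ → ℕ
  zigzag t = zig (parity t) ⌊ t /2⌋

  zigzag-unhalve : ∀ π s → zigzag (unhalve π s) ≡ zig π s
  zigzag-unhalve π s = cong₂ zig (parity-unhalve π s) (⌊unhalve/2⌋ π s)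

  zigzag-step : ∀ t → zigzag t + zigzag (suc t) ≈ bit (parity (suc t))
  zigzag-step t = subst (λ t → zigzag t + zigzag (suc t) ≈ bit (parity (suc t)))
                        (unhalve-⌊/2⌋ t) (step (parity t) ⌊ t /2⌋)
    where
    open ≈-Reasoning
    step : ∀ π s → zigzag (unhalve π s) + zigzag (suc (unhalve π s)) ≈ bit (parity (suc (unhalve π s)))
    step 0ℙ s = begin
      zigzag (s + s) + zigzag (suc (s + s))  ≡⟨ cong₂ _+_ (zigzag-unhalve 0ℙ s) (zigzag-unhalve 1ℙ s) ⟩
      neg s + suc s                          ≡⟨ trans (+-suc (neg s) s) (cong suc (+-comm (neg s) s)) ⟩
      suc (s + neg s)                        ≈⟨ +-congˡ 1 (+-inverseʳ s) ⟩
      1                                      ≡⟨ cong bit (parity-unhalve 1ℙ s) ⟨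
      bit (parity (suc (s + s)))             ∎
    step 1ℙ s = begin
      zigzag (suc (s + s)) + zigzag (suc (suc (s + s)))
        ≡⟨ cong₂ _+_ (zigzag-unhalve 1ℙ s) (cong₂ zig (parity-unhalve 0ℙ s) (cong suc (⌊unhalve/2⌋ 0ℙ s))) ⟩
      suc s + neg (suc s)
        ≈⟨ +-inverseʳ (suc s) ⟩
      0
        ≡⟨ cong bit (parity-unhalve 0ℙ s) ⟨
      bit (parity (s + s))
        ∎

  neg≉suc : ∀ {s s′} → s < M → s′ < M → ¬ (neg s ≈ suc s′)
  neg≉suc {s} {s′} s<M s′<M eq = 1+n≢0 (begin
    suc (s + s′)   ≡⟨ +-suc s s′ ⟨
    s + suc s′     ≡⟨ ≈⇒≡ (+-mono-<-≤ s<M s′<M) z<s (≈-trans (+-congˡ s (≈-sym eq)) (+-inverseʳ s)) ⟩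
    0              ∎)
    where open ≡-Reasoning

  zig-injective : ∀ {π π′ s s′} → s < M → s′ < M → zig π s ≈ zig π′ s′ → π ≡ π′ × s ≡ s′
  zig-injective {0ℙ} {0ℙ} s<M s′<M eq =
    refl , ≈⇒≡ (<-trans s<M M<m) (<-trans s′<M M<m) (neg-injective eq)
  zig-injective {1ℙ} {1ℙ} s<M s′<M eq =
    refl , suc-injective (≈⇒≡ (≤-<-trans s<M M<m) (≤-<-trans s′<M M<m) eq)
  zig-injective {0ℙ} {1ℙ} s<M s′<M eq = ⊥-elim (neg≉suc s<M s′<M eq)
  zig-injective {1ℙ} {0ℙ} s<M s′<M eq = ⊥-elim (neg≉suc s′<M s<M (≈-sym eq))

  ⌊/2⌋<M : ∀ {t} → t < m → ⌊ t /2⌋ < M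
  ⌊/2⌋<M {t} t<m =
    half-< (≤-<-trans (m≤n+m _ (bit (parity t))) (subst (_< m) (sym (unhalve-⌊/2⌋ t)) t<m))

  zigzag-injective : ∀ {t t′} → t < m → t′ < m → zigzag t ≈ zigzag t′ → t ≡ t′
  zigzag-injective {t} {t′} t<m t′<m eq
    with π≡π′ , s≡s′ ← zig-injective {parity t} {parity t′} (⌊/2⌋<M t<m) (⌊/2⌋<M t′<m) eq =
    trans (sym (unhalve-⌊/2⌋ t)) (trans (cong₂ unhalve π≡π′ s≡s′) (unhalve-⌊/2⌋ t′))

  path : Fin M → Fin m → Fin m
  path i t = (toℕ i + zigzag (toℕ t)) mod m

  -- Positions on the cycle and vertices of K_{m+1} alike: zero is ∞ and suc x is x ∈ ℤ_m.
  walecki : Fin M → Fin (suc m) → Fin (suc m)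
  walecki i zero    = zero
  walecki i (suc t) = suc (path i t)

  -- class zero zero is junk: ∞∞ is not an edge.
  class : Fin (suc m) → Fin (suc m) → Fin M
  class zero    zero    = zero
  class zero    (suc y) = toℕ y mod M
  class (suc x) zero    = toℕ x mod M
  class (suc x) (suc y) = ⌊ (toℕ x + toℕ y) % m /2⌋ mod M

  class-comm : ∀ u v → class u v ≡ class v u
  class-comm zero    zero    = refl
  class-comm zero    (suc y) = refl
  class-comm (suc x) zero    = refl
  class-comm (suc x) (suc y) = cong (λ k → ⌊ k % m /2⌋ mod M) (+-comm (toℕ x) (toℕ y))

  path-injective : ∀ i → Injective _≡_ _≡_ (path i)
  path-injective i {t} {t′} eq = toℕ-injective (zigzag-injective (toℕ<n t) (toℕ<n t′)
    (+-cancelˡ (toℕ i) (begin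
      toℕ i + zigzag (toℕ t)    ≈⟨ toℕ-mod _ ⟨
      toℕ (path i t)            ≡⟨ cong toℕ eq ⟩
      toℕ (path i t′)           ≈⟨ toℕ-mod _ ⟩
      toℕ i + zigzag (toℕ t′)   ∎)))
    where open ≈-Reasoning

  walecki-injective : ∀ i → Injective _≡_ _≡_ (walecki i)
  walecki-injective i {zero}  {zero}   _  = refl
  walecki-injective i {suc t} {suc t′} eq = cong suc (path-injective i (sucᶠ-injective eq))

  last : Fin m
  last = fromℕ (a + M)

  path-first : ∀ i → toℕ (path i zero) ≡ toℕ i
  path-first i = ≈⇒≡ (toℕ<n _) (<-trans (toℕ<n i) M<m) (≈-trans (toℕ-mod _) (≡⇒≈ (+-identityʳ (toℕ i))))

  path-last : ∀ i → toℕ (path i last) ≡ toℕ i + M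
  path-last i = ≈⇒≡ (toℕ<n _) (+-monoˡ-< M (toℕ<n i))
                    (≈-trans (toℕ-mod _) (≡⇒≈ (cong (toℕ i +_) zigzag-last)))
    where
    zigzag-last : zigzag (toℕ last) ≡ M
    zigzag-last = trans (cong zigzag (trans (toℕ-fromℕ (a + M)) (+-suc a a))) (zigzag-unhalve 1ℙ a)

  path-step : ∀ i {t t′ : Fin m} → toℕ t′ ≡ suc (toℕ t) →
              toℕ (path i t) + toℕ (path i t′) ≈ unhalve (parity (toℕ t′)) (toℕ i)
  path-step i {t} {t′} t′≡1+t = begin
    toℕ (path i t) + toℕ (path i t′)
      ≈⟨ +-cong (toℕ-mod (I + zigzag T)) (toℕ-mod (I + zigzag (toℕ t′))) ⟩
    (I + zigzag T) + (I + zigzag (toℕ t′))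
      ≡⟨ cong (λ k → (I + zigzag T) + (I + zigzag k)) t′≡1+t ⟩
    (I + zigzag T) + (I + zigzag (suc T))
      ≡⟨ interchange +-commutativeSemigroup I (zigzag T) I (zigzag (suc T)) ⟩
    (I + I) + (zigzag T + zigzag (suc T))
      ≈⟨ +-congˡ (I + I) (zigzag-step T) ⟩
    (I + I) + bit (parity (suc T))
      ≡⟨ trans (cong (λ k → unhalve (parity k) I) t′≡1+t) (+-comm _ (I + I)) ⟨
    unhalve (parity (toℕ t′)) I
      ∎
    where
    open ≈-Reasoning
    I = toℕ i
    T = toℕ t

  unhalve<m : ∀ π {k} → k < M → unhalve π k < m
  unhalve<m 0ℙ k<M     = +-mono-< k<M k<M
  unhalve<m 1ℙ {k} k<M = subst (_≤ m) (+-suc (suc k) k) (+-mono-≤ k<M k<M)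

  class-first : ∀ i → class zero (suc (path i zero)) ≡ i
  class-first i = ModM.≈toℕ⇒mod≡ (ModM.≡⇒≈ (path-first i))

  class-last : ∀ i → class (suc (path i last)) zero ≡ i
  class-last i = ModM.≈toℕ⇒mod≡ (ModM.≈-trans (ModM.≡⇒≈ (path-last i)) (ModM.mk≈ ([m+n]%n≡m%n (toℕ i) M)))

  class-step : ∀ i {t t′ : Fin m} → toℕ t′ ≡ suc (toℕ t) → class (suc (path i t)) (suc (path i t′)) ≡ i
  class-step i {t} {t′} t′≡1+t = ModM.≈toℕ⇒mod≡ (ModM.≡⇒≈ (begin
    ⌊ (toℕ (path i t) + toℕ (path i t′)) % m /2⌋  ≡⟨ cong ⌊_/2⌋ (%-≡ (path-step i t′≡1+t)) ⟩
    ⌊ unhalve π (toℕ i) % m /2⌋                   ≡⟨ cong ⌊_/2⌋ (m<n⇒m%n≡m (unhalve<m π (toℕ<n i))) ⟩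
    ⌊ unhalve π (toℕ i) /2⌋                       ≡⟨ ⌊unhalve/2⌋ π (toℕ i) ⟩
    toℕ i                                         ∎))
    where
    open ≡-Reasoning
    π = parity (toℕ t′)

  class-cycSucc : ∀ i {u v} → CycSucc (suc m) u v → class (walecki i u) (walecki i v) ≡ i
  class-cycSucc i {zero}  {zero}     (inj₂ (() , _))
  class-cycSucc i {zero}  {suc zero} (inj₁ refl)           = class-first i
  class-cycSucc i {suc t} {zero}     (inj₂ (1+t≡m , refl))
    rewrite toℕ-injective {i = t} {j = last} (trans (suc-injective 1+t≡m) (sym (toℕ-fromℕ (a + M))))
    = class-last i
  class-cycSucc i {suc t} {suc t′}   (inj₁ 1+t′≡2+t)       = class-step i (suc-injective 1+t′≡2+t)

  class-cycle : ∀ i {u v} → Cycle (suc m) u v → class (walecki i u) (walecki i v) ≡ i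
  class-cycle i         (inj₁ u→v) = class-cycSucc i u→v
  class-cycle i {u} {v} (inj₂ v→u) = trans (class-comm (walecki i u) (walecki i v)) (class-cycSucc i v→u)

  %M+M : ∀ {y} → M ≤ y → y < m → y % M + M ≡ y
  %M+M {y} M≤y y<m = begin
    y % M + M         ≡⟨ cong (_+ M) (m≤n⇒[n∸m]%m≡n%m M≤y) ⟨
    (y ∸ M) % M + M   ≡⟨ cong (_+ M) (m<n⇒m%n≡m y∸M<M) ⟩
    y ∸ M + M         ≡⟨ m∸n+n≡m M≤y ⟩
    y                 ∎
    where
    open ≡-Reasoning
    y∸M<M : y ∸ M < M
    y∸M<M = +-cancelʳ-< M (y ∸ M) M (subst (_< m) (sym (m∸n+n≡m M≤y)) y<m)

  covers-∞ : ∀ y → InImage (Cycle (suc m)) (walecki (class zero (suc y))) zero (suc y)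
  covers-∞ y with toℕ y <? M
  ... | yes y<M = zero , suc zero , inj₁ (inj₁ refl) , refl ,
    cong suc (toℕ-injective (trans (path-first _) (trans (toℕ-fromℕ< _) (m<n⇒m%n≡m y<M))))
  ... | no y≮M = zero , suc last , inj₂ (inj₂ (cong suc (toℕ-fromℕ (a + M)) , refl)) , refl ,
    cong suc (toℕ-injective (trans (path-last _)
      (trans (cong (_+ M) (toℕ-fromℕ< _)) (%M+M (≮⇒≥ y≮M) (toℕ<n y)))))

  double-last : ∀ {x : Fin m} (i : Fin M) → toℕ x ≡ toℕ i + M → toℕ x + toℕ x ≈ toℕ i + toℕ i
  double-last {x} i x≡i+M =
    ≈-trans (≡⇒≈ (trans (cong₂ _+_ x≡i+M x≡i+M) (regroup (toℕ i) M))) (m+kn≈m (toℕ i + toℕ i) 1)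
    where
    regroup : ∀ k l → (k + l) + (k + l) ≡ (k + k) + 1 * (l + l)
    regroup = solve-∀

  -- x sits somewhere on the path of cycle i. Label sums along the path alternate in parity, so
  -- one of the two path edges at x has the label sum of x + y and hence ends at y; if it is
  -- missing, x is an end i or i + M of the path, which would force x + x = x + y.
  module FiniteEdge {x y : Fin m} (x≢y : x ≢ y) where

    i : Fin M
    i = class (suc x) (suc y)

    s : ℕ
    s = (toℕ x + toℕ y) % m

    x+y≈ : toℕ x + toℕ y ≈ unhalve (parity s) (toℕ i)
    x+y≈ = ≈-trans (≈-sym (m%n≈m _))
                   (≡⇒≈ (trans (sym (unhalve-⌊/2⌋ s)) (cong (unhalve (parity s)) (sym i≡))))
      where
      i≡ : toℕ i ≡ ⌊ s /2⌋
      i≡ = trans (toℕ-fromℕ< _) (m<n⇒m%n≡m (⌊/2⌋<M (m%n<n (toℕ x + toℕ y) m)))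

    edge-sum : ∀ {t t′ : Fin m} → toℕ t′ ≡ suc (toℕ t) → parity (toℕ t′) ≡ parity s →
               toℕ (path i t) + toℕ (path i t′) ≈ toℕ x + toℕ y
    edge-sum {t} {t′} t′≡1+t π≡ = begin
      toℕ (path i t) + toℕ (path i t′)   ≈⟨ path-step i t′≡1+t ⟩
      unhalve (parity (toℕ t′)) (toℕ i)  ≡⟨ cong (λ π → unhalve π (toℕ i)) π≡ ⟩
      unhalve (parity s) (toℕ i)         ≈⟨ x+y≈ ⟨
      toℕ x + toℕ y                      ∎
      where open ≈-Reasoning

    forward : ∀ {t t′ : Fin m} → toℕ t′ ≡ suc (toℕ t) → parity (toℕ t′) ≡ parity s →
              path i t ≡ x → path i t′ ≡ y
    forward t′≡1+t π≡ pt≡x = toℕ-≈⇒≡ (+-cancelˡ (toℕ x)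
      (≈-trans (≡⇒≈ (cong (λ z → toℕ z + _) (sym pt≡x))) (edge-sum t′≡1+t π≡)))

    backward : ∀ {t t′ : Fin m} → toℕ t′ ≡ suc (toℕ t) → parity (toℕ t′) ≡ parity s →
               path i t′ ≡ x → path i t ≡ y
    backward t′≡1+t π≡ pt′≡x = toℕ-≈⇒≡ (+-cancelˡ (toℕ x)
      (≈-trans (≡⇒≈ (trans (+-comm (toℕ x) _) (cong (λ z → _ + toℕ z) (sym pt′≡x)))) (edge-sum t′≡1+t π≡)))

    degenerate : parity s ≡ 0ℙ → toℕ x + toℕ x ≈ toℕ i + toℕ i → ⊥
    degenerate π≡0 x+x≈ = x≢y (toℕ-≈⇒≡ (+-cancelˡ (toℕ x)
      (≈-trans x+x≈ (≈-sym (subst (λ π → toℕ x + toℕ y ≈ unhalve π (toℕ i)) π≡0 x+y≈)))))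

    around : ∀ t → path i t ≡ x → InImage (Cycle (suc m)) (walecki i) (suc x) (suc y)
    around t pt≡x with parity (suc (toℕ t)) ℙ.≟ parity s
    around t pt≡x | yes π≡ with m≤n⇒m<n∨m≡n (toℕ<n t)
    ... | inj₁ 1+t<m = suc t , suc (fromℕ< 1+t<m) , inj₁ (inj₁ (cong suc t′≡)) , cong suc pt≡x ,
                       cong suc (forward t′≡ (trans (cong parity t′≡) π≡) pt≡x)
      where t′≡ = toℕ-fromℕ< 1+t<m
    ... | inj₂ 1+t≡m = ⊥-elim (degenerate (trans (sym π≡) (trans (cong parity 1+t≡m) (parity-unhalve 0ℙ M)))
                                          (double-last {x} i x≡i+M))
      where
      x≡i+M : toℕ x ≡ toℕ i + M
      x≡i+M = trans (cong toℕ (sym pt≡x)) (trans (cong (toℕ ∘ path i) t≡last) (path-last i))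
        where t≡last = toℕ-injective (trans (suc-injective 1+t≡m) (sym (toℕ-fromℕ (a + M))))
    around zero    pt≡x | no π≢ = ⊥-elim (degenerate (≢⇒≡⁻¹ (π≢ ∘ sym))
                                    (≡⇒≈ (cong (λ k → k + k) (trans (cong toℕ (sym pt≡x)) (path-first i)))))
    around (suc t) pt≡x | no π≢ =
      suc (suc t) , suc (inject₁ t) , inj₂ (inj₁ (cong suc t′≡)) , cong suc pt≡x ,
      cong suc (backward t′≡ (sym (trans (≢⇒≡⁻¹ (π≢ ∘ sym)) (ℙ.suc-homo-⁻¹ (suc (toℕ t))))) pt≡x)
      where
      t′≡ : suc (toℕ t) ≡ suc (toℕ (inject₁ t))
      t′≡ = cong suc (sym (toℕ-inject₁ t))

    covers : InImage (Cycle (suc m)) (walecki i) (suc x) (suc y)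
    covers = Product.uncurry around (injective⇒surjective (path-injective i) x)

  isPartition : IsPartition (Cycle (suc m)) walecki
  isPartition = record
    { injective = walecki-injective
    ; class     = λ u v _ → class u v
    ; covers    = covers
    ; unique    = λ { _ i (_ , _ , g , refl , refl) → class-cycle i g }
    }
    where
    covers : ∀ {u v} (u≢v : u ≢ v) → InImage (Cycle (suc m)) (walecki (class u v)) u v
    covers {zero}  {zero}  u≢v = ⊥-elim (u≢v refl)
    covers {zero}  {suc y} _   = covers-∞ y
    covers {suc x} {zero}  _   = InImage-swap Sum.swap (covers-∞ x)
    covers {suc x} {suc y} u≢v = FiniteEdge.covers (u≢v ∘ cong suc)

-- Products of edge partitions

_⊗_ : {V W : Set} → Graph V → Graph W → Graph (V × W)
(G ⊗ H) (v , v′) (w , w′) = G v w × H v′ w′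

map-injective : ∀ {A B C D : Set} {f : A → C} {g : B → D} →
                Injective _≡_ _≡_ f → Injective _≡_ _≡_ g → Injective _≡_ _≡_ (Product.map f g)
map-injective f-inj g-inj eq = cong₂ _,_ (f-inj (cong proj₁ eq)) (g-inj (cong proj₂ eq))

module CartesianSquare
  {V T I : Set} {G : Graph V} {f : I → V → T}
  (P : IsPartition G f) (f-surjective : ∀ i → StrictlySurjective _≡_ (f i))
  (_≟_ : DecidableEquality T) (G-irrefl : ∀ {x} → ¬ G x x)
  (ψ : (V × V) ↔ (V × V))
  (□⇒⊗ : ∀ {p q} → (G □ G) p q → (G ⊗ G) (Inverse.to ψ p) (Inverse.to ψ q))
  (⊗⇒□ : ∀ {p q} → (G ⊗ G) p q → (G □ G) (Inverse.from ψ p) (Inverse.from ψ q))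
  where

  open Inverse ψ using (to; from; strictlyInverseˡ; strictlyInverseʳ)
  module P = IsPartition P

  square : I ⊎ I × I → V × V → T × T
  square (inj₁ i)       = Product.map (f i) (f i)
  square (inj₂ (i , j)) = Product.map (f i) (f j) ∘ to

  square-injective : ∀ k → Injective _≡_ _≡_ (square k)
  square-injective (inj₁ i)       = map-injective (P.injective i) (P.injective i)
  square-injective (inj₂ (i , j)) {p} {q} eq = trans (sym (strictlyInverseʳ p))
    (trans (cong from (map-injective (P.injective i) (P.injective j) eq)) (strictlyInverseʳ q))

  class : (p q : T × T) → p ≢ q → I ⊎ I × I
  class (a , b) (a′ , b′) p≢q with a ≟ a′ | b ≟ b′
  ... | yes a≡a′ | _       = inj₁ (P.class b b′ (p≢q ∘ cong₂ _,_ a≡a′))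
  ... | no a≢a′  | yes _   = inj₁ (P.class a a′ a≢a′)
  ... | no a≢a′  | no b≢b′ = inj₂ (P.class a a′ a≢a′ , P.class b b′ b≢b′)

  vertical : ∀ {a b b′} (b≢b′ : b ≢ b′) →
             InImage (G □ G) (square (inj₁ (P.class b b′ b≢b′))) (a , b) (a , b′)
  vertical {a} b≢b′ with y , y′ , g , fy , fy′ ← P.covers b≢b′ | x , fx ← f-surjective _ a =
    (x , y) , (x , y′) , inj₂ (refl , g) , cong₂ _,_ fx fy , cong₂ _,_ fx fy′

  horizontal : ∀ {a a′ b} (a≢a′ : a ≢ a′) →
               InImage (G □ G) (square (inj₁ (P.class a a′ a≢a′))) (a , b) (a′ , b)
  horizontal {b = b} a≢a′ with x , x′ , g , fx , fx′ ← P.covers a≢a′ | y , fy ← f-surjective _ b =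
    (x , y) , (x′ , y) , inj₁ (g , refl) , cong₂ _,_ fx fy , cong₂ _,_ fx′ fy

  diagonal : ∀ {a a′ b b′} (a≢a′ : a ≢ a′) (b≢b′ : b ≢ b′) →
             InImage (G □ G) (square (inj₂ (P.class a a′ a≢a′ , P.class b b′ b≢b′))) (a , b) (a′ , b′)
  diagonal a≢a′ b≢b′
    with x , x′ , gx , fx , fx′ ← P.covers a≢a′ | y , y′ , gy , fy , fy′ ← P.covers b≢b′ =
    from (x , y) , from (x′ , y′) , ⊗⇒□ (gx , gy) ,
    trans (cong (Product.map (f _) (f _)) (strictlyInverseˡ (x , y))) (cong₂ _,_ fx fy) ,
    trans (cong (Product.map (f _) (f _)) (strictlyInverseˡ (x′ , y′))) (cong₂ _,_ fx′ fy′)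

  covers : ∀ {p q} (p≢q : p ≢ q) → InImage (G □ G) (square (class p q p≢q)) p q
  covers {a , b} {a′ , b′} p≢q with a ≟ a′ | b ≟ b′
  ... | yes refl | _        = vertical (p≢q ∘ cong₂ _,_ refl)
  ... | no a≢a′  | yes refl = horizontal a≢a′
  ... | no a≢a′  | no b≢b′  = diagonal a≢a′ b≢b′

  unique-horizontal : ∀ i {x x′ y} → G x x′ → (p≢q : (f i x , f i y) ≢ (f i x′ , f i y)) →
                      class (f i x , f i y) (f i x′ , f i y) p≢q ≡ inj₁ i
  unique-horizontal i {x} {x′} {y} g p≢q with f i x ≟ f i x′ | f i y ≟ f i y
  ... | yes a≡a′ | _      = ⊥-elim (p≢q (cong₂ _,_ a≡a′ refl))
  ... | no a≢a′  | yes _  = cong inj₁ (P.unique a≢a′ i (x , x′ , g , refl , refl))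
  ... | no _     | no b≢b = ⊥-elim (b≢b refl)

  unique-vertical : ∀ i {x y y′} → G y y′ → (p≢q : (f i x , f i y) ≢ (f i x , f i y′)) →
                    class (f i x , f i y) (f i x , f i y′) p≢q ≡ inj₁ i
  unique-vertical i {x} {y} {y′} g p≢q with f i x ≟ f i x | f i y ≟ f i y′
  ... | yes a≡a | _ = cong inj₁ (P.unique (p≢q ∘ cong₂ _,_ a≡a) i (y , y′ , g , refl , refl))
  ... | no a≢a  | _ = ⊥-elim (a≢a refl)

  unique-diagonal : ∀ i j {x x′ y y′} → G x x′ → G y y′ → (p≢q : (f i x , f j y) ≢ (f i x′ , f j y′)) →
                    class (f i x , f j y) (f i x′ , f j y′) p≢q ≡ inj₂ (i , j)
  unique-diagonal i j {x} {x′} {y} {y′} gx gy p≢q with f i x ≟ f i x′ | f j y ≟ f j y′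
  ... | yes a≡a′ | _        = ⊥-elim (G-irrefl (subst (G x) (sym (P.injective i a≡a′)) gx))
  ... | no _     | yes b≡b′ = ⊥-elim (G-irrefl (subst (G y) (sym (P.injective j b≡b′)) gy))
  ... | no a≢a′  | no b≢b′  = cong₂ (λ k l → inj₂ (k , l))
    (P.unique a≢a′ i (x , x′ , gx , refl , refl)) (P.unique b≢b′ j (y , y′ , gy , refl , refl))

  unique : ∀ {p q} (p≢q : p ≢ q) k → InImage (G □ G) (square k) p q → class p q p≢q ≡ k
  unique p≢q (inj₁ i)       (_ , _ , inj₁ (g , refl) , refl , refl) = unique-horizontal i g p≢q
  unique p≢q (inj₁ i)       (_ , _ , inj₂ (refl , g) , refl , refl) = unique-vertical i g p≢q
  unique p≢q (inj₂ (i , j)) (_ , _ , g , refl , refl) =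
    unique-diagonal i j (proj₁ (□⇒⊗ g)) (proj₂ (□⇒⊗ g)) p≢q

  isPartition : IsPartition (G □ G) square
  isPartition = record
    { injective = square-injective
    ; class     = class
    ; covers    = covers
    ; unique    = unique
    }

-- The isomorphism C_n □ C_n ≅ C_n ⊗ C_n for odd n

module Rotation (M : ℕ) where

  n : ℕ
  n = suc (M + M)

  open Modulo n

  -- The inverse of 2 modulo n.
  w : ℕ
  w = suc M

  rotate : Fin n × Fin n → Fin n × Fin n
  rotate (u , v) = (toℕ u + toℕ v) mod n , (toℕ u + neg (toℕ v)) mod n

  unrotate : Fin n × Fin n → Fin n × Fin n
  unrotate (x , y) = (w * (toℕ x + toℕ y)) mod n , (w * (toℕ x + neg (toℕ y))) mod n

  unrotate-rotate : ∀ p → unrotate (rotate p) ≡ p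
  unrotate-rotate (u , v) = cong₂ _,_
    (≈toℕ⇒mod≡ (begin
      w * (toℕ ((U + V) mod n) + toℕ ((U + neg V) mod n))
        ≈⟨ *-congˡ w (+-cong (toℕ-mod (U + V)) (toℕ-mod (U + neg V))) ⟩
      w * ((U + V) + (U + neg V))
        ≡⟨ identity₁ M U V ⟩
      U + (U + w * V) * n
        ≈⟨ m+kn≈m U (U + w * V) ⟩
      U ∎))
    (≈toℕ⇒mod≡ (begin
      w * (toℕ ((U + V) mod n) + neg (toℕ ((U + neg V) mod n)))
        ≈⟨ *-congˡ w (+-cong (toℕ-mod (U + V)) (neg-cong (toℕ-mod (U + neg V)))) ⟩
      w * ((U + V) + neg (U + neg V))
        ≡⟨ identity₂ M U V ⟩
      V + (w * U + M * n * V) * n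
        ≈⟨ m+kn≈m V (w * U + M * n * V) ⟩
      V ∎))
    where
    open ≈-Reasoning
    U = toℕ u
    V = toℕ v
    identity₁ : ∀ M x y → suc M * ((x + y) + (x + y * (M + M))) ≡ x + (x + suc M * y) * suc (M + M)
    identity₁ = solve-∀
    identity₂ : ∀ M x y → suc M * ((x + y) + (x + y * (M + M)) * (M + M)) ≡
                          y + (suc M * x + M * suc (M + M) * y) * suc (M + M)
    identity₂ = solve-∀

  rotate-unrotate : ∀ p → rotate (unrotate p) ≡ p
  rotate-unrotate (x , y) = cong₂ _,_
    (≈toℕ⇒mod≡ (begin
      toℕ ((w * (X + Y)) mod n) + toℕ ((w * (X + neg Y)) mod n)
        ≈⟨ +-cong (toℕ-mod (w * (X + Y))) (toℕ-mod (w * (X + neg Y))) ⟩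
      w * (X + Y) + w * (X + neg Y)
        ≡⟨ identity₁ M X Y ⟩
      X + (X + w * Y) * n
        ≈⟨ m+kn≈m X (X + w * Y) ⟩
      X ∎))
    (≈toℕ⇒mod≡ (begin
      toℕ ((w * (X + Y)) mod n) + neg (toℕ ((w * (X + neg Y)) mod n))
        ≈⟨ +-cong (toℕ-mod (w * (X + Y))) (neg-cong (toℕ-mod (w * (X + neg Y)))) ⟩
      w * (X + Y) + neg (w * (X + neg Y))
        ≡⟨ identity₂ M X Y ⟩
      Y + (w * X + M * n * Y) * n
        ≈⟨ m+kn≈m Y (w * X + M * n * Y) ⟩
      Y ∎))
    where
    open ≈-Reasoning
    X = toℕ x
    Y = toℕ y
    identity₁ : ∀ M x y → suc M * (x + y) + suc M * (x + y * (M + M)) ≡ x + (x + suc M * y) * suc (M + M)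
    identity₁ = solve-∀
    identity₂ : ∀ M x y → suc M * (x + y) + suc M * (x + y * (M + M)) * (M + M) ≡
                          y + (suc M * x + M * suc (M + M) * y) * suc (M + M)
    identity₂ = solve-∀

  rotation : (Fin n × Fin n) ↔ (Fin n × Fin n)
  rotation = mk↔ₛ′ rotate unrotate rotate-unrotate unrotate-rotate

  halve-step : ∀ {x x′ y y′} → Step x x′ → Step y y′ → Step (w * (x + y)) (w * (x′ + y′))
  halve-step {x} {x′} {y} {y′} x′≈1+x y′≈1+y = begin
    w * (x′ + y′)               ≈⟨ *-congˡ w (+-cong x′≈1+x y′≈1+y) ⟩
    w * (suc x + suc y)         ≡⟨ identity M x y ⟩
    suc (w * (x + y)) + 1 * n   ≈⟨ m+kn≈m (suc (w * (x + y))) 1 ⟩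
    suc (w * (x + y))           ∎
    where
    open ≈-Reasoning
    identity : ∀ M x y → suc M * (suc x + suc y) ≡ suc (suc M * (x + y)) + 1 * suc (M + M)
    identity = solve-∀

  rotate-□⇒⊗ : ∀ {p q} → (Cycle n □ Cycle n) p q → (Cycle n ⊗ Cycle n) (rotate p) (rotate q)
  rotate-□⇒⊗ {_ , v} (inj₁ (c , refl)) =
    adjacent⇒cycle (Sum.map (+-stepʳ (toℕ v)) (+-stepʳ (toℕ v)) u~u′) ,
    adjacent⇒cycle (Sum.map (+-stepʳ (neg (toℕ v))) (+-stepʳ (neg (toℕ v))) u~u′)
    where u~u′ = cycle⇒adjacent c
  rotate-□⇒⊗ {u , _} (inj₂ (refl , c)) =
    adjacent⇒cycle (Sum.map (+-stepˡ (toℕ u)) (+-stepˡ (toℕ u)) v~v′) ,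
    adjacent⇒cycle (Sum.swap (Sum.map (+-stepˡ (toℕ u) ∘ neg-step) (+-stepˡ (toℕ u) ∘ neg-step) v~v′))
    where v~v′ = cycle⇒adjacent c

  unrotate-⊗⇒□ : ∀ {p q} → (Cycle n ⊗ Cycle n) p q → (Cycle n □ Cycle n) (unrotate p) (unrotate q)
  unrotate-⊗⇒□ (cx , cy) with cycle⇒adjacent cx | cycle⇒adjacent cy
  ... | inj₁ x→x′ | inj₁ y→y′ = inj₁ (adjacent⇒cycle (inj₁ (halve-step x→x′ y→y′)) ,
                                     mod-cong (*-congˡ w (step-cancel x→x′ (neg-step y→y′))))
  ... | inj₂ x′→x | inj₂ y′→y = inj₁ (adjacent⇒cycle (inj₂ (halve-step x′→x y′→y)) ,
                                     mod-cong (*-congˡ w (≈-sym (step-cancel x′→x (neg-step y′→y)))))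
  ... | inj₁ x→x′ | inj₂ y′→y = inj₂ (mod-cong (*-congˡ w (step-cancel x→x′ y′→y)) ,
                                     adjacent⇒cycle (inj₁ (halve-step x→x′ (neg-step y′→y))))
  ... | inj₂ x′→x | inj₁ y→y′ = inj₂ (mod-cong (*-congˡ w (≈-sym (step-cancel x′→x y→y′))) ,
                                     adjacent⇒cycle (inj₂ (halve-step x′→x (neg-step y→y′))))

[1+2M]²≡1+4[M+M²] : ∀ M → suc (M + M) * suc (M + M) ≡ suc ((M + M * M) * 4)
[1+2M]²≡1+4[M+M²] = solve-∀

cycleSquare-partition : ∀ {N} M .{{_ : NonZero M}} → N ≡ suc (M + M) →
                        PartitionInto (N * N) ((N * N ∸ 1) / 4) (Cycle N □ Cycle N)
cycleSquare-partition {N} M@(suc a) refl =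
  subst (λ k → PartitionInto (N * N) k (Cycle N □ Cycle N)) M+M²≡[N²∸1]/4
    (isPartition⇒partitionInto (isPartition-↔ (↔-trans +↔⊎ (↔-refl ⊎-↔ *↔×)) (↔-sym *↔×)
      (CartesianSquare.isPartition W.isPartition (injective⇒surjective ∘ W.walecki-injective) _≟ᶠ_
        (Modulo.cycle-irrefl N (s≤s (s≤s z≤n))) R.rotation R.rotate-□⇒⊗ R.unrotate-⊗⇒□)))
  where
  module W = Walecki a
  module R = Rotation M
  M+M²≡[N²∸1]/4 : M + M * M ≡ (N * N ∸ 1) / 4
  M+M²≡[N²∸1]/4 = trans (sym (m*n/n≡m (M + M * M) 4)) (cong (λ x → (x ∸ 1) / 4) (sym ([1+2M]²≡1+4[M+M²] M)))

prime≢2⇒odd : ∀ {p} → Prime p → p ≢ 2 → Σ ℕ λ q → p ≡ suc (suc q + suc q)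
prime≢2⇒odd {p} p-prime p≢2 = from-halves (parity p) ⌊ p /2⌋ (unhalve-⌊/2⌋ p)
  where
  double : ∀ h → h + h ≡ h * 2
  double = solve-∀
  from-halves : ∀ π h → unhalve π h ≡ p → Σ ℕ λ q → p ≡ suc (suc q + suc q)
  from-halves 0ℙ h h+h≡p with prime⇒irreducible p-prime (divides h (trans (sym h+h≡p) (double h)))
  ... | inj₁ ()
  ... | inj₂ 2≡p = ⊥-elim (p≢2 (sym 2≡p))
  from-halves 1ℙ zero    1≡p     = ⊥-elim (¬prime[1] (subst Prime (sym 1≡p) p-prime))
  from-halves 1ℙ (suc q) 1+h+h≡p = q , sym 1+h+h≡p

[1+2h]²≡1+2M : ∀ h → suc (h + h) ^ 2 ≡ suc ((h * suc h + h * suc h) + (h * suc h + h * suc h))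
[1+2h]²≡1+2M = expanded
  where
  expanded : ∀ h → suc (h + h) * (suc (h + h) * 1) ≡ suc ((h * suc h + h * suc h) + (h * suc h + h * suc h))
  expanded = solve-∀

theorem2 : (p : ℕ) → Prime p → p ≢ 2 →
    PartitionInto (p ^ 4) ((p ^ 4 ∸ 1) / 4) (Cycle (p ^ 2) □ Cycle (p ^ 2))
theorem2 p p-prime p≢2 with q , refl ← prime≢2⇒odd p-prime p≢2 =
  subst (λ m → PartitionInto m ((m ∸ 1) / 4) (Cycle (p ^ 2) □ Cycle (p ^ 2)))
        (sym (^-distribˡ-+-* p 2 2))
        (cycleSquare-partition (suc q * suc (suc q) + suc q * suc (suc q)) ([1+2h]²≡1+2M (suc q)))
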